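{- Let $v$ be a positive integer and let $L=\{a_1^{m_1},a_2^{m_2},\ldots,a_t^{m_t}\}$ be a list of $k\leq v$ elements of $\{1,2,\ldots,\lfloor v/2\rfloor\}$ with $\gcd(v,a_1,a_2,\ldots,a_t)=1$. If there exists a $k$-cycle $C$ of $K_v$ such that $\ell(C)=L$, then for every divisor $d>1$ of $v$, the number of multiples of $d$ appearing in $L$ (counted with multiplicity) does not exceed $\frac{k}{v}(v-d)$.
   Context: The complete graph $K_v$ has vertex set $\mathbb{Z}_v=\{0,1,\ldots,v-1\}$. The length of an edge $[x,y]$ of $K_v$ is $\ell(x,y)=\min(|x-y|,\,v-|x-y|)$. For a subgraph $\Gamma$ of $K_v$, $\ell(\Gamma)$ is the multiset of the lengths of all edges of $\Gamma$ (with multiplicity). The notation $\{a_1^{m_1},\ldots,a_t^{m_t}\}$ denotes the multiset consisting of $m_i$ copies of $a_i$ for each $i$, with $a_1,\ldots,a_t$ distinct, so $k=m_1+\cdots+m_t$. A $k$-cycle of $K_v$ is a cycle on $k$ distinct vertices. -}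

module Defs where

open import Data.Nat using (ℕ; _≤_; _<_; _∸_; ∣_-_∣; _⊓_; _/_)
open import Data.Nat.GCD using (gcd)
open import Data.Fin using (Fin; toℕ)
open import Data.List using (List; []; _∷_; _++_; [_]; zipWith; foldr; length)
open import Data.List.Relation.Unary.Unique.Propositional using (Unique)
open import Data.Product using (_×_)

edgeLength : (v : ℕ) → Fin v → Fin v → ℕ
edgeLength v x y = ∣ toℕ x - toℕ y ∣ ⊓ (v ∸ ∣ toℕ x - toℕ y ∣)

-- a cycle is given by its cyclic vertex sequence (x₁,...,x_k); its edges are
-- [x₁,x₂],...,[x_{k-1},x_k],[x_k,x₁]
cycleLengths : (v : ℕ) → List (Fin v) → List ℕ
cycleLengths v []       = []
cycleLengths v (x ∷ xs) = zipWith (edgeLength v) (x ∷ xs) (xs ++ [ x ])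

IsCycle : (v k : ℕ) → List (Fin v) → Set
IsCycle v k xs = (length xs ≡ k) × (3 ≤ k) × Unique xs
  where open import Relation.Binary.PropositionalEquality using (_≡_)

-- gcd(v, a₁, ..., a_t) (repetitions do not affect the gcd)
gcdList : ℕ → List ℕ → ℕ
gcdList v L = foldr gcd v L

module Submission where

-- Let C = (x₁, …, x_k) be the cycle and d > 1 a divisor of v = m·d.
-- Colour every vertex by its residue mod d.  An edge has length divisible by d
-- exactly when its endpoints have the same colour, so if c denotes the number
-- of colour changes around C, then (#multiples of d in L) + c = k.
--   * c ≥ 1: otherwise every length in L is a multiple of d, and then d divides
--     gcd(v, a₁, …, a_t) = 1.
--   * k ≤ c·m: the colour changes cut C into c maximal monochromatic runs, and a
--     run consists of distinct vertices of one residue class, which has only m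
--     elements.
-- Eliminating c from these two facts gives the bound (k − c)·v ≤ k·(v − d).

open import Defs
open import Data.Nat using (ℕ; _≤_; _<_; _*_; _∸_; _/_)
open import Data.Nat.Divisibility using (_∣_; _∣?_)
open import Data.Fin using (Fin)
open import Data.List using (List; length; filter)
open import Data.List.Relation.Unary.All using (All)
open import Data.List.Relation.Binary.Permutation.Propositional using (_↭_)
open import Data.Product using (_×_; ∃)
open import Relation.Binary.PropositionalEquality using (_≡_)

open import Data.Nat using (zero; suc; _+_; _%_; NonZero; >-nonZero; z≤n; s≤s; ∣_-_∣; _⊓_; _≟_)
open import Data.Nat.Properties
open import Data.Nat.Divisibility using (divides; ∣m+n∣m⇒∣n; ∣1⇒≡1)
open import Data.Nat.DivMod using (m≡m%n+[m/n]*n; %-remove-+ʳ; m<n*o⇒m/o<n)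
open import Data.Nat.GCD using (gcd-greatest)
open import Algebra.Properties.CommutativeSemigroup +-commutativeSemigroup using (interchange; x∙yz≈y∙xz)
open import Data.Fin using (zero; suc; toℕ; fromℕ<)
open import Data.Fin.Properties using (toℕ-injective; toℕ<n; toℕ-fromℕ<; injective⇒≤)
open import Data.List using ([]; _∷_; _++_; [_]; zipWith; lookup)
open import Data.List.Properties using (length-++; ++-assoc; ++-identityʳ; filter-++; filter-complete)
open import Data.List.Membership.Propositional using (_∈_)
open import Data.List.Membership.Propositional.Properties using (∈-lookup)
open import Data.List.Relation.Unary.All using ([]; _∷_)
import Data.List.Relation.Unary.All as All
import Data.List.Relation.Unary.All.Properties as All
open import Data.List.Relation.Unary.AllPairs using ([]; _∷_)
open import Data.List.Relation.Unary.Unique.Propositional using (Unique)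
open import Data.List.Relation.Binary.Sublist.Propositional using (_⊆_; []; _∷_; _∷ʳ_; ⊆-refl)
open import Data.List.Relation.Binary.Sublist.Propositional.Properties using (All-resp-⊆; ++⁺; ++⁺ˡ; ++⁺ʳ)
open import Data.List.Relation.Binary.Permutation.Propositional.Properties using (↭-length; filter-↭)
open import Data.Product using (_,_)
open import Data.Sum using (inj₁; inj₂)
open import Data.Empty using (⊥-elim)
open import Function using (_∘_; _⇔_; mk⇔; Equivalence)
open import Function.Definitions using (Injective)
open import Function.Construct.Composition using (_⇔-∘_)
open import Relation.Nullary using (yes; no; contradiction)
open import Relation.Unary using (Decidable)
open import Relation.Binary.Definitions using (DecidableEquality)
open import Relation.Binary.PropositionalEquality using (refl; sym; trans; cong; cong₂; subst; module ≡-Reasoning)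

open Equivalence using (to; from)

lookup-injective : ∀ {A : Set} {xs : List A} → Unique xs → Injective _≡_ _≡_ (lookup xs)
lookup-injective (x∉xs ∷ _) {zero}  {zero}  _  = refl
lookup-injective (x∉xs ∷ _) {zero}  {suc j} eq = ⊥-elim (All.lookup x∉xs (∈-lookup j) eq)
lookup-injective (x∉xs ∷ _) {suc i} {zero}  eq = ⊥-elim (All.lookup x∉xs (∈-lookup i) (sym eq))
lookup-injective (_ ∷ u)    {suc i} {suc j} eq = cong suc (lookup-injective u eq)

length≤-injectiveOn : ∀ {A : Set} {m} (f : A → Fin m) {xs : List A} → Unique xs →
  (∀ {x y} → x ∈ xs → y ∈ xs → f x ≡ f y → x ≡ y) → length xs ≤ m
length≤-injectiveOn f {xs} u injOn =
  injective⇒≤ {f = f ∘ lookup xs} (lookup-injective u ∘ injOn (∈-lookup _) (∈-lookup _))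

unique-⊆ : ∀ {A : Set} {xs ys : List A} → xs ⊆ ys → Unique ys → Unique xs
unique-⊆ []         []       = []
unique-⊆ (_ ∷ʳ xs⊆) (_ ∷ u)  = unique-⊆ xs⊆ u
unique-⊆ (refl ∷ xs⊆) (y∉ ∷ u) = All-resp-⊆ xs⊆ y∉ ∷ unique-⊆ xs⊆ u

module _ {A : Set} (P R Y : List A) where

  unique-middle : Unique (P ++ R ++ Y) → Unique R
  unique-middle = unique-⊆ (++⁺ˡ P (++⁺ʳ Y ⊆-refl))

  unique-dropMiddle : Unique (P ++ R ++ Y) → Unique (P ++ Y)
  unique-dropMiddle = unique-⊆ (++⁺ (⊆-refl {x = P}) (++⁺ˡ R ⊆-refl))

  length-middle : length (P ++ R ++ Y) ≡ length R + length (P ++ Y)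
  length-middle = begin
    length (P ++ R ++ Y)               ≡⟨ length-++ P ⟩
    length P + length (R ++ Y)         ≡⟨ cong (length P +_) (length-++ R) ⟩
    length P + (length R + length Y)   ≡⟨ x∙yz≈y∙xz (length P) (length R) (length Y) ⟩
    length R + (length P + length Y)   ≡⟨ cong (length R +_) (sym (length-++ P)) ⟩
    length R + length (P ++ Y)         ∎
    where open ≡-Reasoning

filter-full⇒All : ∀ {A : Set} {P : A → Set} (P? : Decidable P) (xs : List A) →
  length (filter P? xs) ≡ length xs → All P xs
filter-full⇒All P? xs full = subst (All _) (filter-complete P? full) (All.all-filter P? xs)

module Colouring {A C : Set} (_≟ᶜ_ : DecidableEquality C) (colour : A → C) where

  differ : C → C → ℕ
  differ a b with a ≟ᶜ b
  ... | yes _ = 0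
  ... | no  _ = 1

  -- changes c ys e: the number of colour changes along a walk that starts at
  -- colour c, then visits ys in order and finally steps to a vertex of colour e.
  changes : C → List A → C → ℕ
  changes c []       e = differ c e
  changes c (y ∷ ys) e = differ c (colour y) + changes (colour y) ys e

  Monochrome : C → List A → Set
  Monochrome c = All (λ x → colour x ≡ c)

  -- Suppose the colour is kept along a step a → b exactly when its label w a b
  -- satisfies P.  Then each step of the closed walk y, xs, x (back to x) is
  -- counted either by the filter or as a colour change.
  module _ {B : Set} (w : A → A → B) {P : B → Set} (P? : Decidable P)
           (detects : ∀ a b → P (w a b) ⇔ colour a ≡ colour b) where

    step-count : ∀ a b → length (filter P? [ w a b ]) + differ (colour a) (colour b) ≡ 1
    step-count a b with colour a ≟ᶜ colour b | P? (w a b)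
    ... | yes _    | yes _  = refl
    ... | yes same | no ¬p  = contradiction (from (detects a b) same) ¬p
    ... | no diff  | yes p  = contradiction (to (detects a b) p) diff
    ... | no _     | no _   = refl

    kept+changes : ∀ x y xs →
      length (filter P? (zipWith w (y ∷ xs) (xs ++ [ x ]))) + changes (colour y) xs (colour x)
        ≡ suc (length xs)
    kept+changes x y []       = step-count y x
    kept+changes x y (z ∷ zs) = begin
      length (filter P? ([ w y z ] ++ rest)) + (δ + c)         ≡⟨ cong (λ l → length l + (δ + c)) (filter-++ P? [ w y z ] rest) ⟩
      length (filter P? [ w y z ] ++ filter P? rest) + (δ + c) ≡⟨ cong (_+ (δ + c)) (length-++ (filter P? [ w y z ])) ⟩
      (n₁ + nᵣ) + (δ + c)                                     ≡⟨ interchange n₁ nᵣ δ c ⟩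
      (n₁ + δ) + (nᵣ + c)                                     ≡⟨ cong₂ _+_ (step-count y z) (kept+changes x z zs) ⟩
      suc (suc (length zs))                                   ∎
      where
      open ≡-Reasoning
      rest : List B
      rest = zipWith w (z ∷ zs) (zs ++ [ x ])
      n₁ nᵣ δ c : ℕ
      n₁ = length (filter P? [ w y z ])
      nᵣ = length (filter P? rest)
      δ = differ (colour y) (colour z)
      c = changes (colour z) zs (colour x)

  module _ (m : ℕ) (class-bound : ∀ {c xs} → Unique xs → Monochrome c xs → length xs ≤ m) where

    -- The final run R closes the walk: it costs m further vertices unless it
    -- has the colour e of the first run P, in which case P ++ R is one class.
    closing : ∀ {c e} (P R : List A) → Unique (P ++ R) → Monochrome e P → Monochrome c R →
      length (P ++ R) ≤ suc (differ c e) * m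
    closing {c} {e} P R u mP mR with c ≟ᶜ e
    ... | yes refl = ≤-trans (class-bound u (All.++⁺ mP mR)) (m≤m+n m 0)
    ... | no _ = begin
      length (P ++ R)     ≡⟨ length-++ P ⟩
      length P + length R ≤⟨ +-mono-≤ (class-bound (unique-⊆ (++⁺ʳ R ⊆-refl) u) mP)
                                      (m≤n⇒m≤n+o 0 (class-bound (unique-⊆ (++⁺ˡ P ⊆-refl) u) mR)) ⟩
      m + (m + 0)         ∎
      where open ≤-Reasoning

    -- After the first run P (of colour e, the colour the walk returns to) the
    -- walk is in a run R of colour c and still has to visit ys.  Each finished
    -- later run costs at most m vertices; the final run is paid for by the
    -- closing change, or it has colour e and then forms one class with P.
    later-runs : ∀ {c e} ys (P R : List A) → Unique (P ++ R ++ ys) →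
      Monochrome e P → Monochrome c R → length (P ++ R ++ ys) ≤ suc (changes c ys e) * m
    later-runs [] P R u mP mR = subst (λ l → length (P ++ l) ≤ _) (sym (++-identityʳ R))
      (closing P R (subst (λ l → Unique (P ++ l)) (++-identityʳ R) u) mP mR)
    later-runs {c} (y ∷ ys) P R u mP mR with c ≟ᶜ colour y
    ... | yes refl = subst (λ l → length (P ++ l) ≤ _) (++-assoc R [ y ] ys)
      (later-runs ys P (R ++ [ y ]) (subst (λ l → Unique (P ++ l)) (sym (++-assoc R [ y ] ys)) u)
        mP (All.++⁺ mR (refl ∷ [])))
    ... | no _ = begin
      length (P ++ R ++ y ∷ ys)           ≡⟨ length-middle P R (y ∷ ys) ⟩
      length R + length (P ++ [ y ] ++ ys) ≤⟨ +-mono-≤ (class-bound (unique-middle P R (y ∷ ys) u) mR)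
                                                       (later-runs ys P [ y ] (unique-dropMiddle P R (y ∷ ys) u) mP (refl ∷ [])) ⟩
      m + suc (changes (colour y) ys _) * m ∎
      where open ≤-Reasoning

    first-run : ∀ {e} ys (P : List A) → Unique (P ++ ys) → Monochrome e P →
      1 ≤ changes e ys e → length (P ++ ys) ≤ changes e ys e * m
    first-run {e} [] P u mP changed with e ≟ᶜ e
    ... | yes _   = contradiction changed λ ()
    ... | no e≢e  = contradiction refl e≢e
    first-run {e} (y ∷ ys) P u mP changed with e ≟ᶜ colour y
    ... | yes refl = subst (λ l → length l ≤ _) (++-assoc P [ y ] ys)
      (first-run ys (P ++ [ y ]) (subst Unique (sym (++-assoc P [ y ] ys)) u)
        (All.++⁺ mP (refl ∷ [])) changed)
    ... | no _ = later-runs ys P [ y ] u mP (refl ∷ [])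

    cycle-bound : ∀ x xs → Unique (x ∷ xs) → 1 ≤ changes (colour x) xs (colour x) →
      suc (length xs) ≤ changes (colour x) xs (colour x) * m
    cycle-bound x xs u = first-run xs [ x ] u (refl ∷ [])

∣∸⇔%≡ : ∀ d .{{_ : NonZero d}} {A B} → B ≤ A → d ∣ A ∸ B ⇔ A % d ≡ B % d
∣∸⇔%≡ d {A} {B} B≤A = mk⇔ congruent divisible
  where
  open ≡-Reasoning
  congruent : d ∣ A ∸ B → A % d ≡ B % d
  congruent d∣A∸B = trans (cong (_% d) (sym (m+[n∸m]≡n B≤A))) (%-remove-+ʳ B d∣A∸B)
  divisible : A % d ≡ B % d → d ∣ A ∸ B
  divisible eq = divides (A / d ∸ B / d) (begin
    A ∸ B                                        ≡⟨ cong₂ _∸_ (m≡m%n+[m/n]*n A d) (m≡m%n+[m/n]*n B d) ⟩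
    (A % d + A / d * d) ∸ (B % d + B / d * d)    ≡⟨ cong (λ r → (r + A / d * d) ∸ (B % d + B / d * d)) eq ⟩
    (B % d + A / d * d) ∸ (B % d + B / d * d)    ≡⟨ [m+n]∸[m+o]≡n∸o (B % d) _ _ ⟩
    A / d * d ∸ B / d * d                        ≡⟨ sym (*-distribʳ-∸ d (A / d) (B / d)) ⟩
    (A / d ∸ B / d) * d                          ∎)

∣dist⇔%≡ : ∀ d .{{_ : NonZero d}} A B → d ∣ ∣ A - B ∣ ⇔ A % d ≡ B % d
∣dist⇔%≡ d A B with ≤-total B A
... | inj₁ B≤A = subst (λ D → d ∣ D ⇔ A % d ≡ B % d) (sym (m≤n⇒∣n-m∣≡n∸m B≤A)) (∣∸⇔%≡ d B≤A)
... | inj₂ A≤B = subst (λ D → d ∣ D ⇔ A % d ≡ B % d) (sym (m≤n⇒∣m-n∣≡n∸m A≤B))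
                   (mk⇔ (sym ∘ to (∣∸⇔%≡ d A≤B)) (from (∣∸⇔%≡ d A≤B) ∘ sym))

∣-complement : ∀ {d v D} → d ∣ v → D ≤ v → d ∣ D → d ∣ v ∸ D
∣-complement d∣v D≤v = ∣m+n∣m⇒∣n (subst (_ ∣_) (sym (m+[n∸m]≡n D≤v)) d∣v)

∣cyclic⇔∣ : ∀ {d v D} → d ∣ v → D ≤ v → d ∣ D ⊓ (v ∸ D) ⇔ d ∣ D
∣cyclic⇔∣ {d} {v} {D} d∣v D≤v with ⊓-sel D (v ∸ D)
... | inj₁ min≡D   = subst (λ M → d ∣ M ⇔ d ∣ D) (sym min≡D) (mk⇔ (λ p → p) (λ p → p))
... | inj₂ min≡v∸D = subst (λ M → d ∣ M ⇔ d ∣ D) (sym min≡v∸D)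
      (mk⇔ (subst (d ∣_) (m∸[m∸n]≡n D≤v) ∘ ∣-complement d∣v (m∸n≤m v D)) (∣-complement d∣v D≤v))

edgeLength-∣⇔ : ∀ {v d} .{{_ : NonZero d}} → d ∣ v → (x y : Fin v) →
  d ∣ edgeLength v x y ⇔ toℕ x % d ≡ toℕ y % d
edgeLength-∣⇔ {v} {d} d∣v x y = ∣dist⇔%≡ d (toℕ x) (toℕ y) ⇔-∘ ∣cyclic⇔∣ d∣v dist≤v
  where
  dist≤v : ∣ toℕ x - toℕ y ∣ ≤ v
  dist≤v = ≤-trans (∣m-n∣≤m⊔n (toℕ x) (toℕ y)) (⊔-lub (<⇒≤ (toℕ<n x)) (<⇒≤ (toℕ<n y)))

-- A residue class mod d in Z_{m·d} has m elements: distinct vertices of one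
-- class have distinct quotients by d, and these are below m.
residue-class-bound : ∀ {m d v} .{{_ : NonZero d}} → v ≡ m * d → ∀ {c} {xs : List (Fin v)} →
  Unique xs → All (λ x → toℕ x % d ≡ c) xs → length xs ≤ m
residue-class-bound {m} {d} {v} v≡md {c} {xs} u sameClass = length≤-injectiveOn quotient u injOn
  where
  quotient : Fin v → Fin m
  quotient x = fromℕ< (m<n*o⇒m/o<n (subst (toℕ x <_) v≡md (toℕ<n x)))
  toℕ-quotient : ∀ x → toℕ (quotient x) ≡ toℕ x / d
  toℕ-quotient x = toℕ-fromℕ< _
  injOn : ∀ {x y} → x ∈ xs → y ∈ xs → quotient x ≡ quotient y → x ≡ y
  injOn {x} {y} x∈xs y∈xs eq = toℕ-injective (begin
    toℕ x                     ≡⟨ m≡m%n+[m/n]*n (toℕ x) d ⟩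
    toℕ x % d + toℕ x / d * d ≡⟨ cong₂ (λ r q → r + q * d) sameResidue sameQuotient ⟩
    toℕ y % d + toℕ y / d * d ≡⟨ sym (m≡m%n+[m/n]*n (toℕ y) d) ⟩
    toℕ y                     ∎)
    where
    open ≡-Reasoning
    sameResidue : toℕ x % d ≡ toℕ y % d
    sameResidue = trans (All.lookup sameClass x∈xs) (sym (All.lookup sameClass y∈xs))
    sameQuotient : toℕ x / d ≡ toℕ y / d
    sameQuotient = trans (sym (toℕ-quotient x)) (trans (cong toℕ eq) (toℕ-quotient y))

∣gcdList : ∀ {d} v L → d ∣ v → All (d ∣_) L → d ∣ gcdList v L
∣gcdList v []      d∣v []           = d∣v
∣gcdList v (_ ∷ L) d∣v (d∣a ∷ d∣L) = gcd-greatest d∣a (∣gcdList v L d∣v d∣L)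

count-bound : ∀ {S c k} m → S + c ≡ k → k ≤ c * m → S * m ≤ k * (m ∸ 1)
count-bound {S} zero    _ _ = ≤-trans (≤-reflexive (*-zeroʳ S)) z≤n
count-bound {S} {c} {k} (suc m) S+c≡k k≤cm = begin
  S * suc m          ≡⟨ *-suc S m ⟩
  S + S * m          ≤⟨ +-monoˡ-≤ (S * m) S≤cm ⟩
  c * m + S * m      ≡⟨ +-comm (c * m) (S * m) ⟩
  S * m + c * m      ≡⟨ sym (*-distribʳ-+ m S c) ⟩
  (S + c) * m        ≡⟨ cong (_* m) S+c≡k ⟩
  k * m              ∎
  where
  open ≤-Reasoning
  S≤cm : S ≤ c * m
  S≤cm = +-cancelʳ-≤ c S (c * m)
    (≤-trans (≤-reflexive S+c≡k) (≤-trans k≤cm (≤-reflexive (trans (*-suc c m) (+-comm c (c * m))))))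

count-bound-scaled : ∀ {S c k} m d → S + c ≡ k → k ≤ c * m → S * (m * d) ≤ k * (m * d ∸ d)
count-bound-scaled {S} {c} {k} m d S+c≡k k≤cm = begin
  S * (m * d)        ≡⟨ sym (*-assoc S m d) ⟩
  S * m * d          ≤⟨ *-monoˡ-≤ d (count-bound {S} {c} m S+c≡k k≤cm) ⟩
  k * (m ∸ 1) * d    ≡⟨ *-assoc k (m ∸ 1) d ⟩
  k * ((m ∸ 1) * d)  ≡⟨ cong (k *_) (trans (*-distribʳ-∸ d m 1) (cong (m * d ∸_) (*-identityˡ d))) ⟩
  k * (m * d ∸ d)    ∎
  where open ≤-Reasoning

proposition3p5 : (v : ℕ) → 1 ≤ v → (L : List ℕ) → length L ≤ v →
    All (λ a → 1 ≤ a × a ≤ v / 2) L → gcdList v L ≡ 1 →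
    ∃ (λ (C : List (Fin v)) → IsCycle v (length L) C × (cycleLengths v C ↭ L)) →
    (d : ℕ) → d ∣ v → 1 < d →
    length (filter (d ∣?_) L) * v ≤ length L * (v ∸ d)
proposition3p5 v _ L _ _ _ ([] , (lenC , 3≤k , _) , _) _ _ _ =
  contradiction (subst (3 ≤_) (sym lenC) 3≤k) λ ()
proposition3p5 v _ L _ _ gcd≡1 (x ∷ xs , (lenC , _ , uniqueC) , C↭L) d d∣v@(divides m v≡md) 1<d =
  subst (λ n → S * n ≤ k * (n ∸ d)) (sym v≡md)
    (count-bound-scaled {S} {c} m d S+c≡k (subst (_≤ c * m) lenC runs))
  where
  instance
    d≢0 : NonZero d
    d≢0 = >-nonZero (<-trans (s≤s z≤n) 1<d)
  open Colouring _≟_ (λ (y : Fin v) → toℕ y % d)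
  k S c : ℕ
  k = length L
  S = length (filter (d ∣?_) L)
  c = changes (toℕ x % d) xs (toℕ x % d)
  -- the multiples of d in L are the monochromatic edges of the cycle
  S+c≡k : S + c ≡ k
  S+c≡k = trans (cong (_+ c) (sym (↭-length (filter-↭ (d ∣?_) C↭L))))
                (trans (kept+changes (edgeLength v) (d ∣?_) (edgeLength-∣⇔ d∣v) x x xs) lenC)
  -- without a colour change every length is a multiple of d, so d ∣ gcd = 1
  changed : 1 ≤ c
  changed = n≢0⇒n>0 λ c≡0 → <⇒≢ 1<d (sym (∣1⇒≡1 (subst (d ∣_) gcd≡1
    (∣gcdList v L d∣v (filter-full⇒All (d ∣?_) L
      (trans (sym (+-identityʳ S)) (trans (cong (S +_) (sym c≡0)) S+c≡k)))))))
  runs : suc (length xs) ≤ c * m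
  runs = cycle-bound m (residue-class-bound v≡md) x xs uniqueC changed
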